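{- Let $n\ge 3$. There exist infinitely many profiles $\mathbf{p}\in\mathbb{Q}^{n!}$ such that for every permutation $\pi\in S_n$ with $\pi(n)\neq 1$ there is some $\mathbf{w}(\pi)\in W$ with $T_{\mathbf{w}(\pi)}\mathbf{p}\in C_\pi$.
   Context: Work over $\mathbb{Q}$. Let $W=\{\mathbf{x}\in\mathbb{Q}^n:\ x_1>\cdots>x_n,\ x_1+\cdots+x_n=0\}$ (strict weighting vectors). For $\sigma\in S_n$ let $C_\sigma=\{\mathbf{x}\in\mathbb{Q}^n:\ x_{\sigma(1)}>x_{\sigma(2)}>\cdots>x_{\sigma(n)}\}$ (the ranking in which candidate $\sigma(k)$ is in $k$-th place). Index the permutations of $S_n$ as $\sigma_1,\dots,\sigma_{n!}$ (lexicographically in one-line notation), and let $R_\ell$ be the $n\times n$ permutation matrix with $R_\ell(i,j)=1$ if $\sigma_\ell(j)=i$ and $0$ otherwise. A profile is a vector $\mathbf{p}\in\mathbb{Q}^{n!}$ ($p_\ell$ = number of voters with preference $\sigma_\ell$). For $\mathbf{w}\in W$, $T_{\mathbf{w}}$ is the $n\times n!$ matrix whose $\ell$-th column is $R_\ell\mathbf{w}$, so $T_{\mathbf{w}}\mathbf{p}=\sum_{\ell}p_\ell R_\ell\mathbf{w}$ is the results vector. -}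

module Defs where

open import Data.Nat as ℕ using (ℕ; zero; suc; _∸_)
open import Data.Nat using (_!)
open import Data.Fin as Fin using (Fin; toℕ; _≟_)
open import Data.Fin.Permutation using (Permutation′; _⟨$⟩ʳ_)
open import Data.Rational as ℚ using (ℚ; 0ℚ; 1ℚ; _+_; _*_; _<_)
open import Data.List using (List; []; _∷_; [_]; map; concatMap; filter; foldr; allFin; zip)
open import Data.Vec as Vec using (Vec; toList; lookup)
open import Data.Product using (_×_; _,_)
open import Relation.Binary.PropositionalEquality using (_≡_; _≢_)
open import Relation.Nullary using (¬_; does)
open import Data.Bool using (if_then_else_)
open import Relation.Nullary.Decidable using (¬?)

sumℚ : List ℚ → ℚ
sumℚ = foldr _+_ 0ℚ

ΣFin : ∀ {n} → (Fin n → ℚ) → ℚ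
ΣFin {n} f = sumℚ (map f (allFin n))

arrangements : ∀ {n} (k : ℕ) → List (Fin n) → List (Vec (Fin n) k)
arrangements zero    _ = [ Vec.[] ]
arrangements (suc k) L =
  concatMap (λ x → map (x Vec.∷_) (arrangements k (filter (λ y → ¬? (y ≟ x)) L))) L

-- σ_1, …, σ_{n!}: the permutations of S_n (one-line notation) in lexicographic order
lexPerms : (n : ℕ) → List (Vec (Fin n) n)
lexPerms n = arrangements n (allFin n)

R : ∀ {n} → Vec (Fin n) n → Fin n → Fin n → ℚ
R σ i j = if does (lookup σ j ≟ i) then 1ℚ else 0ℚ

_·ᵥ_ : ∀ {n} → (Fin n → Fin n → ℚ) → (Fin n → ℚ) → (Fin n → ℚ)
(M ·ᵥ v) i = ΣFin (λ j → M i j * v j)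

-- profiles: vectors in ℚ^{n!}, p_ℓ = number of voters with preference σ_ℓ
Profile : ℕ → Set
Profile n = Vec ℚ (n !)

T : ∀ {n} → (Fin n → ℚ) → Profile n → (Fin n → ℚ)
T {n} w p i = sumℚ (map (λ { (pℓ , σ) → pℓ * ((R σ ·ᵥ w) i) }) (zip (toList p) (lexPerms n)))

W : ∀ {n} → (Fin n → ℚ) → Set
W w = (∀ i j → i Fin.< j → w j < w i) × ΣFin w ≡ 0ℚ

C : ∀ {n} → Permutation′ n → (Fin n → ℚ) → Set
C π x = ∀ k l → k Fin.< l → x (π ⟨$⟩ʳ l) < x (π ⟨$⟩ʳ k)

-- π(n) ≠ 1  (positions/candidates 1..n are Fin indices 0..n-1)
LastNotFirst : ∀ {n} → Permutation′ n → Set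
LastNotFirst {n} π = ∀ j → toℕ j ≡ n ∸ 1 → toℕ (π ⟨$⟩ʳ j) ≢ 0

-- Number the candidates 0, …, n − 1 and put n′ = n − 1. Let ρ be the ranking placing candidate j + 1
-- in place j and candidate 0 last, let τ_b place candidate b + 1 last, and let σ swap the first and the
-- last place. If n′κ = c + 1, the profile
--   p₁ = c (ρ − id) + κ Σ_b (τ_b − σ τ_b)
-- gives candidate 0 the score w₀ − w_{n′} and candidate i > 0 the score c (w_{i−1} − w_i) − κ (w₀ − w_{n′}).
-- So the results are an affine image of the gaps w_{i−1} − w_i, and any positive gaps come from a strict
-- weighting vector. For a ranking π, give the candidates placed above 0 much larger gaps than those placed
-- below it, each gap decreasing in the place: the first group then beats candidate 0, who beats the
-- second. Beating candidate 0 needs the sum of all gaps to be small against one large gap, which holds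
-- because at least one candidate, the one placed last, is below 0. Positive multiples y p₁ realise the
-- same rankings, and the linear functional p ↦ (T_{e₀} p)₀, equal to y at y p₁, tells them apart.

module Submission where

open import Defs
open import Algebra.Bundles using (CommutativeRing)
import Algebra.Properties.Semiring.Mult
open import Data.Bool using (if_then_else_)
open import Data.Empty using (⊥-elim)
open import Data.Fin as Fin using (Fin; _≟_)
open import Data.Fin.Permutation as Perm using (Permutation′; _⟨$⟩ʳ_; _⟨$⟩ˡ_; _∘ₚ_)
import Data.Fin.Permutation.Components as PC
import Data.Fin.Properties as FinP
open import Data.List as List using (List; []; _∷_; map; allFin; length; concatMap; filter; zip; _++_)
open import Data.List.Membership.Propositional using (_∈_; _∉_)
open import Data.List.Membership.Propositional.Properties using (∈-map⁺)
import Data.List.Properties as LP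
import Data.List.Relation.Unary.All as All
open import Data.List.Relation.Unary.Any using (here; there)
open import Data.Nat as ℕ using (ℕ; zero; suc; _≤_; _∸_; _!; z≤n; s≤s)
open import Data.Nat.Combinatorics.Base using (_P′_)
open import Data.Nat.Combinatorics.Specification using (nP′k≡n[n∸1P′k∸1]; nP′n≡n!)
import Data.Nat.Properties as ℕP
open import Data.Nat.Solver using () renaming (module +-*-Solver to ℕ-Solver)
open import Data.Product using (_×_; _,_; Σ; ∃)
open import Data.Rational as ℚ using (ℚ; 0ℚ; 1ℚ; _+_; _*_; _<_; -_; _-_)
import Data.Rational.Properties as ℚP
open import Data.Rational.Solver using (module +-*-Solver)
open import Data.Sum using (inj₁; inj₂)
open import Data.Unit using (⊤; tt)
open import Data.Vec as Vec using (Vec)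
import Data.Vec.Properties as VecP
open import Function using (_∘_)
open import Relation.Binary.Bundles using (DecTotalOrder)
open import Relation.Binary.PropositionalEquality
open import Relation.Nullary using (¬_; yes; no; does)
open import Relation.Nullary.Decidable using (¬?)

open import Data.List.Extrema (DecTotalOrder.totalOrder ℚP.≤-decTotalOrder) using (max; xs≤max; v≤max⁺)

private variable
  A B : Set

module ℚ-Mult = Algebra.Properties.Semiring.Mult (CommutativeRing.semiring ℚP.+-*-commutativeRing)

ι : ℕ → ℚ
ι m = m ℚ-Mult.× 1ℚ

ι-+ : ∀ a b → ι (a ℕ.+ b) ≡ ι a + ι b
ι-+ a b = ℚ-Mult.×-homo-+ 1ℚ a b

ι-* : ∀ a b → ι (a ℕ.* b) ≡ ι a * ι b
ι-* = ℚ-Mult.×1-homo-*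

ι<ι-suc : ∀ m → ι m < ι (suc m)
ι<ι-suc m = subst (_< 1ℚ + ι m) (ℚP.+-identityˡ (ι m)) (ℚP.+-monoˡ-< (ι m) (ℚP.positive⁻¹ 1ℚ))

ι-mono-< : ∀ {m n} → m ℕ.< n → ι m < ι n
ι-mono-< {m} {suc n} (s≤s m≤n) with ℕP.m≤n⇒m<n∨m≡n m≤n
... | inj₁ m<n  = ℚP.<-trans (ι-mono-< m<n) (ι<ι-suc n)
... | inj₂ refl = ι<ι-suc m

0<ι-suc : ∀ m → 0ℚ < ι (suc m)
0<ι-suc m = ι-mono-< {0} {suc m} (s≤s z≤n)

sumℚ-++ : ∀ xs ys → sumℚ (xs ++ ys) ≡ sumℚ xs + sumℚ ys
sumℚ-++ []       ys = sym (ℚP.+-identityˡ _)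
sumℚ-++ (x ∷ xs) ys = trans (cong (x +_) (sumℚ-++ xs ys)) (sym (ℚP.+-assoc x _ _))

sumℚ-map-cong : ∀ {f g : A → ℚ} → (∀ x → f x ≡ g x) → ∀ xs → sumℚ (map f xs) ≡ sumℚ (map g xs)
sumℚ-map-cong f≗g xs = cong sumℚ (LP.map-cong f≗g xs)

sumℚ-map-zero : ∀ {f : A → ℚ} → (∀ x → f x ≡ 0ℚ) → ∀ xs → sumℚ (map f xs) ≡ 0ℚ
sumℚ-map-zero f≗0 []       = refl
sumℚ-map-zero f≗0 (x ∷ xs) = cong₂ _+_ (f≗0 x) (sumℚ-map-zero f≗0 xs)

sumℚ-map-+ : ∀ (f g : A → ℚ) xs → sumℚ (map (λ x → f x + g x) xs) ≡ sumℚ (map f xs) + sumℚ (map g xs)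
sumℚ-map-+ f g []       = refl
sumℚ-map-+ f g (x ∷ xs) = trans (cong (f x + g x +_) (sumℚ-map-+ f g xs))
  (solve 4 (λ a b c d → (a :+ b) :+ (c :+ d) := (a :+ c) :+ (b :+ d)) refl (f x) (g x) _ _)
  where open +-*-Solver

sumℚ-map-*ˡ : ∀ a (f : A → ℚ) xs → sumℚ (map (λ x → a * f x) xs) ≡ a * sumℚ (map f xs)
sumℚ-map-*ˡ a f []       = sym (ℚP.*-zeroʳ a)
sumℚ-map-*ˡ a f (x ∷ xs) = trans (cong (a * f x +_) (sumℚ-map-*ˡ a f xs)) (sym (ℚP.*-distribˡ-+ a (f x) _))

sumℚ-map-const : ∀ a (xs : List A) → sumℚ (map (λ _ → a) xs) ≡ ι (length xs) * a
sumℚ-map-const a []       = sym (ℚP.*-zeroˡ a)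
sumℚ-map-const a (x ∷ xs) = trans (cong (a +_) (sumℚ-map-const a xs))
  (solve 2 (λ a m → a :+ m :* a := (con 1ℚ :+ m) :* a) refl a (ι (length xs)))
  where open +-*-Solver

sumℚ-concatMap : ∀ (f : B → ℚ) (g : A → List B) xs →
  sumℚ (map f (concatMap g xs)) ≡ sumℚ (map (λ x → sumℚ (map f (g x))) xs)
sumℚ-concatMap f g []       = refl
sumℚ-concatMap f g (x ∷ xs) = begin
  sumℚ (map f (g x ++ concatMap g xs))                  ≡⟨ cong sumℚ (LP.map-++ f (g x) _) ⟩
  sumℚ (map f (g x) ++ map f (concatMap g xs))          ≡⟨ sumℚ-++ (map f (g x)) _ ⟩
  sumℚ (map f (g x)) + sumℚ (map f (concatMap g xs))    ≡⟨ cong (sumℚ (map f (g x)) +_) (sumℚ-concatMap f g xs) ⟩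
  sumℚ (map f (g x)) + sumℚ (map (λ x → sumℚ (map f (g x))) xs) ∎
  where open ≡-Reasoning

sumℚ-swap : ∀ (f : A → B → ℚ) xs ys →
  sumℚ (map (λ x → sumℚ (map (f x) ys)) xs) ≡ sumℚ (map (λ y → sumℚ (map (λ x → f x y) xs)) ys)
sumℚ-swap f []       ys = sym (sumℚ-map-zero (λ _ → refl) ys)
sumℚ-swap f (x ∷ xs) ys =
  trans (cong (sumℚ (map (f x) ys) +_) (sumℚ-swap f xs ys)) (sym (sumℚ-map-+ (f x) _ ys))

sumℚ-zip-scale : ∀ a (G : ℚ × B → ℚ) → (∀ p y → G (a * p , y) ≡ a * G (p , y)) →
  ∀ xs ys → sumℚ (map G (zip (map (a *_) xs) ys)) ≡ a * sumℚ (map G (zip xs ys))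
sumℚ-zip-scale a G G-hom []       ys       = sym (ℚP.*-zeroʳ a)
sumℚ-zip-scale a G G-hom (x ∷ xs) []       = sym (ℚP.*-zeroʳ a)
sumℚ-zip-scale a G G-hom (x ∷ xs) (y ∷ ys) =
  trans (cong₂ _+_ (G-hom x y) (sumℚ-zip-scale a G G-hom xs ys)) (sym (ℚP.*-distribˡ-+ a _ _))

ΣFin-suc : ∀ {n} (f : Fin (suc n) → ℚ) → ΣFin f ≡ f Fin.zero + ΣFin (f ∘ Fin.suc)
ΣFin-suc {n} f = cong (λ xs → f Fin.zero + sumℚ xs)
  (trans (LP.map-tabulate Fin.suc f) (sym (LP.map-tabulate (λ i → i) (f ∘ Fin.suc))))

ΣFin-const : ∀ {n} a → ΣFin {n} (λ _ → a) ≡ ι n * a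
ΣFin-const {n} a = trans (sumℚ-map-const a (allFin n)) (cong (λ m → ι m * a) (LP.length-tabulate {n = n} (λ i → i)))

ΣFin-point : ∀ {n} (f : Fin n → ℚ) i → (∀ j → j ≢ i → f j ≡ 0ℚ) → ΣFin f ≡ f i
ΣFin-point {suc n} f Fin.zero    f≡0 = trans (ΣFin-suc f)
  (trans (cong (f Fin.zero +_) (sumℚ-map-zero (λ j → f≡0 (Fin.suc j) λ ()) (allFin n))) (ℚP.+-identityʳ _))
ΣFin-point {suc n} f (Fin.suc i) f≡0 = trans (ΣFin-suc f)
  (trans (cong₂ _+_ (f≡0 Fin.zero λ ()) (ΣFin-point (f ∘ Fin.suc) i λ j j≢i → f≡0 (Fin.suc j) (j≢i ∘ FinP.suc-injective)))
    (ℚP.+-identityˡ _))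

-- Arrangements and permutations

length-concatMap-const : ∀ (f : A → List B) c xs → (∀ x → x ∈ xs → length (f x) ≡ c) →
  length (concatMap f xs) ≡ length xs ℕ.* c
length-concatMap-const f c []       _    = refl
length-concatMap-const f c (x ∷ xs) each = trans (LP.length-++ (f x))
  (cong₂ ℕ._+_ (each x (here refl)) (length-concatMap-const f c xs (λ y y∈xs → each y (there y∈xs))))

*-pred-P′ : ∀ m k → m ℕ.* (ℕ.pred m P′ k) ≡ m P′ suc k
*-pred-P′ zero    k = sym (cong (ℕ._* (0 P′ k)) (ℕP.0∸n≡0 k))
*-pred-P′ (suc m) k = sym (nP′k≡n[n∸1P′k∸1] (suc m) (suc k))

module _ {n : ℕ} where

  remove : Fin n → List (Fin n) → List (Fin n)
  remove x = filter (λ y → ¬? (y ≟ x))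

  multiplicity : Fin n → List (Fin n) → ℕ
  multiplicity x []      = 0
  multiplicity x (y ∷ L) = if does (y ≟ x) then suc (multiplicity x L) else multiplicity x L

  multiplicity-remove-≢ : ∀ {x y} L → y ≢ x → multiplicity y (remove x L) ≡ multiplicity y L
  multiplicity-remove-≢ {x} {y} []      y≢x = refl
  multiplicity-remove-≢ {x} {y} (z ∷ L) y≢x with z ≟ x
  ... | yes refl with z ≟ y
  ...   | yes refl = ⊥-elim (y≢x refl)
  ...   | no _     = multiplicity-remove-≢ L y≢x
  multiplicity-remove-≢ {x} {y} (z ∷ L) y≢x | no _ with z ≟ y
  ...   | yes _ = cong suc (multiplicity-remove-≢ L y≢x)
  ...   | no _  = multiplicity-remove-≢ L y≢x

  multiplicity-remove-≤ : ∀ x y L → multiplicity y (remove x L) ≤ multiplicity y L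
  multiplicity-remove-≤ x y []      = z≤n
  multiplicity-remove-≤ x y (z ∷ L) with z ≟ x
  ... | yes _ with z ≟ y
  ...   | yes _ = ℕP.m≤n⇒m≤1+n (multiplicity-remove-≤ x y L)
  ...   | no _  = multiplicity-remove-≤ x y L
  multiplicity-remove-≤ x y (z ∷ L) | no _ with z ≟ y
  ...   | yes _ = s≤s (multiplicity-remove-≤ x y L)
  ...   | no _  = multiplicity-remove-≤ x y L

  length-remove : ∀ x L → length (remove x L) ℕ.+ multiplicity x L ≡ length L
  length-remove x []      = refl
  length-remove x (z ∷ L) with z ≟ x
  ... | yes _ = trans (ℕP.+-suc _ _) (cong suc (length-remove x L))
  ... | no _  = cong suc (length-remove x L)

  ∈⇒multiplicity≥1 : ∀ {x L} → x ∈ L → 1 ≤ multiplicity x L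
  ∈⇒multiplicity≥1 {x} {z ∷ L} x∈L with z ≟ x | x∈L
  ... | yes _   | _          = s≤s z≤n
  ... | no z≢x  | here refl  = ⊥-elim (z≢x refl)
  ... | no _    | there x∈L′ = ∈⇒multiplicity≥1 x∈L′

  sumℚ-indicator : ∀ x v L → sumℚ (map (λ y → if does (y ≟ x) then v else 0ℚ) L) ≡ ι (multiplicity x L) * v
  sumℚ-indicator x v []      = sym (ℚP.*-zeroˡ v)
  sumℚ-indicator x v (z ∷ L) with z ≟ x
  ... | yes _ = trans (cong (v +_) (sumℚ-indicator x v L))
    (solve 2 (λ v m → v :+ m :* v := (con 1ℚ :+ m) :* v) refl v (ι (multiplicity x L)))
    where open +-*-Solver
  ... | no _  = trans (ℚP.+-identityˡ _) (sumℚ-indicator x v L)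

  IsArrangement : ∀ {k} → Vec (Fin n) k → List (Fin n) → Set
  IsArrangement Vec.[]       L = ⊤
  IsArrangement (x Vec.∷ τ) L = multiplicity x L ≡ 1 × IsArrangement τ (remove x L)

  δ : ∀ {k} → Vec (Fin n) k → Vec (Fin n) k → ℚ
  δ σ τ = if does (VecP.≡-dec _≟_ σ τ) then 1ℚ else 0ℚ

  δ-∷-≡ : ∀ {k} x (σ τ : Vec (Fin n) k) → δ (x Vec.∷ σ) (x Vec.∷ τ) ≡ δ σ τ
  δ-∷-≡ x σ τ with x ≟ x
  ... | yes _   = refl
  ... | no x≢x = ⊥-elim (x≢x refl)

  δ-∷-≢ : ∀ {k x y} (σ τ : Vec (Fin n) k) → y ≢ x → δ (y Vec.∷ σ) (x Vec.∷ τ) ≡ 0ℚ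
  δ-∷-≢ {x = x} {y} σ τ y≢x with y ≟ x
  ... | yes y≡x = ⊥-elim (y≢x y≡x)
  ... | no _    = refl

  sumℚ-δ-arrangements : ∀ k L (τ : Vec (Fin n) k) → IsArrangement τ L → (g : Vec (Fin n) k → ℚ) →
    sumℚ (map (λ σ → δ σ τ * g σ) (arrangements k L)) ≡ g τ
  sumℚ-δ-arrangements zero    L Vec.[]       _             g = trans (ℚP.+-identityʳ _) (ℚP.*-identityˡ _)
  sumℚ-δ-arrangements (suc k) L (x Vec.∷ τ) (once , arr) g = begin
    sumℚ (map (λ σ → δ σ (x Vec.∷ τ) * g σ) (arrangements (suc k) L))
      ≡⟨ sumℚ-concatMap _ _ L ⟩
    sumℚ (map (λ y → sumℚ (map (λ σ → δ σ (x Vec.∷ τ) * g σ) (map (y Vec.∷_) (arrangements k (remove y L))))) L)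
      ≡⟨ sumℚ-map-cong branch L ⟩
    sumℚ (map (λ y → if does (y ≟ x) then g (x Vec.∷ τ) else 0ℚ) L)
      ≡⟨ sumℚ-indicator x _ L ⟩
    ι (multiplicity x L) * g (x Vec.∷ τ)
      ≡⟨ cong (λ m → ι m * g (x Vec.∷ τ)) once ⟩
    ι 1 * g (x Vec.∷ τ)
      ≡⟨ trans (cong (_* g (x Vec.∷ τ)) (ℚP.+-identityʳ 1ℚ)) (ℚP.*-identityˡ _) ⟩
    g (x Vec.∷ τ) ∎
    where
    open ≡-Reasoning
    branch : ∀ y → sumℚ (map (λ σ → δ σ (x Vec.∷ τ) * g σ) (map (y Vec.∷_) (arrangements k (remove y L))))
                   ≡ (if does (y ≟ x) then g (x Vec.∷ τ) else 0ℚ)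
    branch y with y ≟ x
    ... | yes refl = trans (cong sumℚ (sym (LP.map-∘ (arrangements k (remove y L)))))
      (trans (sumℚ-map-cong (λ σ → cong (_* g (y Vec.∷ σ)) (δ-∷-≡ y σ τ)) (arrangements k (remove y L)))
        (sumℚ-δ-arrangements k (remove y L) τ arr (g ∘ (y Vec.∷_))))
    ... | no y≢x  = trans (cong sumℚ (sym (LP.map-∘ (arrangements k (remove y L)))))
      (sumℚ-map-zero (λ σ → trans (cong (_* g (y Vec.∷ σ)) (δ-∷-≢ σ τ y≢x)) (ℚP.*-zeroˡ (g (y Vec.∷ σ))))
        (arrangements k (remove y L)))

  length-remove-once : ∀ x L → multiplicity x L ≡ 1 → length (remove x L) ≡ ℕ.pred (length L)
  length-remove-once x L once = sym (begin
    ℕ.pred (length L)                                 ≡⟨ cong ℕ.pred (sym (length-remove x L)) ⟩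
    ℕ.pred (length (remove x L) ℕ.+ multiplicity x L) ≡⟨ cong (λ m → ℕ.pred (length (remove x L) ℕ.+ m)) once ⟩
    ℕ.pred (length (remove x L) ℕ.+ 1)                ≡⟨ cong ℕ.pred (ℕP.+-comm _ 1) ⟩
    length (remove x L)                               ∎)
    where open ≡-Reasoning

  length-arrangements : ∀ k (L : List (Fin n)) → (∀ y → multiplicity y L ≤ 1) →
    length (arrangements k L) ≡ length L P′ k
  length-arrangements zero    L _       = refl
  length-arrangements (suc k) L atMost1 =
    trans (length-concatMap-const _ (ℕ.pred (length L) P′ k) L each) (*-pred-P′ (length L) k)
    where
    each : ∀ y → y ∈ L → length (map (y Vec.∷_) (arrangements k (remove y L))) ≡ ℕ.pred (length L) P′ k
    each y y∈L = begin
      length (map (y Vec.∷_) (arrangements k (remove y L)))  ≡⟨ LP.length-map _ (arrangements k (remove y L)) ⟩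
      length (arrangements k (remove y L))                   ≡⟨ length-arrangements k (remove y L) atMost1′ ⟩
      length (remove y L) P′ k                               ≡⟨ cong (_P′ k) (length-remove-once y L once) ⟩
      ℕ.pred (length L) P′ k                                 ∎
      where
      open ≡-Reasoning
      atMost1′ : ∀ z → multiplicity z (remove y L) ≤ 1
      atMost1′ z = ℕP.≤-trans (multiplicity-remove-≤ y z L) (atMost1 z)
      once : multiplicity y L ≡ 1
      once = ℕP.≤-antisym (atMost1 y) (∈⇒multiplicity≥1 y∈L)

multiplicity-map-suc : ∀ {n} (y : Fin n) L → multiplicity (Fin.suc y) (map Fin.suc L) ≡ multiplicity y L
multiplicity-map-suc y []      = refl
multiplicity-map-suc y (z ∷ L) with z ≟ y
... | yes _ = cong suc (multiplicity-map-suc y L)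
... | no _  = multiplicity-map-suc y L

multiplicity-zero-map-suc : ∀ {n} (L : List (Fin n)) → multiplicity Fin.zero (map Fin.suc L) ≡ 0
multiplicity-zero-map-suc []      = refl
multiplicity-zero-map-suc (z ∷ L) = multiplicity-zero-map-suc L

multiplicity-allFin : ∀ {n} (y : Fin n) → multiplicity y (allFin n) ≡ 1
multiplicity-allFin {suc n} y =
  trans (cong (multiplicity y ∘ (Fin.zero ∷_)) (sym (LP.map-tabulate (λ i → i) Fin.suc))) (at y)
  where
  at : ∀ y → multiplicity y (Fin.zero ∷ map Fin.suc (allFin n)) ≡ 1
  at Fin.zero    = cong suc (multiplicity-zero-map-suc (allFin n))
  at (Fin.suc y) = trans (multiplicity-map-suc y (allFin n)) (multiplicity-allFin y)

module _ {n : ℕ} where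

  tabulate-isArrangement : ∀ {k} (h : Fin k → Fin n) L → (∀ {i j} → h i ≡ h j → i ≡ j) →
    (∀ i → multiplicity (h i) L ≡ 1) → IsArrangement (Vec.tabulate h) L
  tabulate-isArrangement {zero}  h L _   _    = tt
  tabulate-isArrangement {suc k} h L inj once = once Fin.zero ,
    tabulate-isArrangement (h ∘ Fin.suc) (remove (h Fin.zero) L) (FinP.suc-injective ∘ inj)
      (λ i → trans (multiplicity-remove-≢ L (λ eq → FinP.0≢1+n (sym (inj eq)))) (once (Fin.suc i)))

  ⟨$⟩ʳ-injective : ∀ (ρ : Permutation′ n) {i j} → ρ ⟨$⟩ʳ i ≡ ρ ⟨$⟩ʳ j → i ≡ j
  ⟨$⟩ʳ-injective ρ eq = trans (sym (Perm.inverseˡ ρ)) (trans (cong (ρ ⟨$⟩ˡ_) eq) (Perm.inverseˡ ρ))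

  oneLine : Permutation′ n → Vec (Fin n) n
  oneLine ρ = Vec.tabulate (ρ ⟨$⟩ʳ_)

  oneLine-isArrangement : ∀ ρ → IsArrangement (oneLine ρ) (allFin n)
  oneLine-isArrangement ρ = tabulate-isArrangement (ρ ⟨$⟩ʳ_) (allFin n) (⟨$⟩ʳ-injective ρ) (multiplicity-allFin ∘ (ρ ⟨$⟩ʳ_))

length-lexPerms : ∀ n → length (lexPerms n) ≡ n !
length-lexPerms n = begin
  length (lexPerms n)       ≡⟨ length-arrangements n (allFin n) (ℕP.≤-reflexive ∘ multiplicity-allFin) ⟩
  length (allFin n) P′ n    ≡⟨ cong (_P′ n) (LP.length-tabulate {n = n} (λ i → i)) ⟩
  n P′ n                    ≡⟨ nP′n≡n! n ⟩
  n !                       ∎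
  where open ≡-Reasoning

-- Profiles as linear combinations of rankings

zip-map-self : ∀ (f : B → A) ys → zip (map f ys) ys ≡ map (λ y → (f y , y)) ys
zip-map-self f []       = refl
zip-map-self f (y ∷ ys) = cong ((f y , y) ∷_) (zip-map-self f ys)

fromWeights : ∀ n → (Vec (Fin n) n → ℚ) → Profile n
fromWeights n f = Vec.cast (trans (LP.length-map f (lexPerms n)) (length-lexPerms n)) (Vec.fromList (map f (lexPerms n)))

T-fromWeights : ∀ {n} (f : Vec (Fin n) n → ℚ) w i →
  T w (fromWeights n f) i ≡ sumℚ (map (λ σ → f σ * (R σ ·ᵥ w) i) (lexPerms n))
T-fromWeights {n} f w i = cong sumℚ (begin
  map _ (zip (Vec.toList (fromWeights n f)) (lexPerms n))  ≡⟨ cong (λ ps → map _ (zip ps (lexPerms n))) toList-fromWeights ⟩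
  map _ (zip (map f (lexPerms n)) (lexPerms n))           ≡⟨ cong (map _) (zip-map-self f (lexPerms n)) ⟩
  map _ (map (λ σ → (f σ , σ)) (lexPerms n))              ≡⟨ LP.map-∘ (lexPerms n) ⟨
  map (λ σ → f σ * (R σ ·ᵥ w) i) (lexPerms n)             ∎)
  where
  open ≡-Reasoning
  toList-fromWeights : Vec.toList (fromWeights n f) ≡ map f (lexPerms n)
  toList-fromWeights = trans (VecP.toList-cast _ (Vec.fromList (map f (lexPerms n)))) (VecP.toList∘fromList _)

R-oneLine : ∀ {n} (ρ : Permutation′ n) w i → (R (oneLine ρ) ·ᵥ w) i ≡ w (ρ ⟨$⟩ˡ i)
R-oneLine ρ w i = trans (ΣFin-point _ (ρ ⟨$⟩ˡ i) off) on
  where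
  entry : ∀ j → R (oneLine ρ) i j ≡ (if does (ρ ⟨$⟩ʳ j ≟ i) then 1ℚ else 0ℚ)
  entry j = cong (λ c → if does (c ≟ i) then 1ℚ else 0ℚ) (VecP.lookup∘tabulate (ρ ⟨$⟩ʳ_) j)
  off : ∀ j → j ≢ ρ ⟨$⟩ˡ i → R (oneLine ρ) i j * w j ≡ 0ℚ
  off j j≢ρ⁻¹i with ρ ⟨$⟩ʳ j ≟ i | entry j
  ... | yes ρj≡i | _ = ⊥-elim (j≢ρ⁻¹i (trans (sym (Perm.inverseˡ ρ)) (cong (ρ ⟨$⟩ˡ_) ρj≡i)))
  ... | no _     | e = trans (cong (_* w j) e) (ℚP.*-zeroˡ (w j))
  on : R (oneLine ρ) i (ρ ⟨$⟩ˡ i) * w (ρ ⟨$⟩ˡ i) ≡ w (ρ ⟨$⟩ˡ i)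
  on with ρ ⟨$⟩ʳ (ρ ⟨$⟩ˡ i) ≟ i | entry (ρ ⟨$⟩ˡ i)
  ... | yes _  | e = trans (cong (_* w (ρ ⟨$⟩ˡ i)) e) (ℚP.*-identityˡ _)
  ... | no ≢i | _ = ⊥-elim (≢i (Perm.inverseʳ ρ))

Combination : ℕ → Set
Combination n = List (ℚ × Permutation′ n)

profile : ∀ {n} → Combination n → Profile n
profile {n} cs = fromWeights n (λ σ → sumℚ (map (λ (c , ρ) → c * δ σ (oneLine ρ)) cs))

T-profile : ∀ {n} (cs : Combination n) w i → T w (profile cs) i ≡ sumℚ (map (λ (c , ρ) → c * w (ρ ⟨$⟩ˡ i)) cs)
T-profile {n} cs w i = begin
  T w (profile cs) i
    ≡⟨ T-fromWeights _ w i ⟩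
  sumℚ (map (λ σ → sumℚ (map (λ (c , ρ) → c * δ σ (oneLine ρ)) cs) * g σ) (lexPerms n))
    ≡⟨ sumℚ-map-cong (λ σ → trans (ℚP.*-comm _ (g σ)) (trans (sym (sumℚ-map-*ˡ (g σ) _ cs))
         (sumℚ-map-cong (λ (c , ρ) → solve 3 (λ x y z → x :* (y :* z) := y :* (z :* x)) refl (g σ) c (δ σ (oneLine ρ))) cs)))
         (lexPerms n) ⟩
  sumℚ (map (λ σ → sumℚ (map (λ (c , ρ) → c * (δ σ (oneLine ρ) * g σ)) cs)) (lexPerms n))
    ≡⟨ sumℚ-swap (λ σ (c , ρ) → c * (δ σ (oneLine ρ) * g σ)) (lexPerms n) cs ⟩
  sumℚ (map (λ (c , ρ) → sumℚ (map (λ σ → c * (δ σ (oneLine ρ) * g σ)) (lexPerms n))) cs)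
    ≡⟨ sumℚ-map-cong (λ (c , ρ) → trans (sumℚ-map-*ˡ c _ (lexPerms n))
         (cong (c *_) (trans (sumℚ-δ-arrangements n (allFin n) (oneLine ρ) (oneLine-isArrangement ρ) g) (R-oneLine ρ w i)))) cs ⟩
  sumℚ (map (λ (c , ρ) → c * w (ρ ⟨$⟩ˡ i)) cs) ∎
  where
  open ≡-Reasoning
  open +-*-Solver
  g : Vec (Fin n) n → ℚ
  g σ = (R σ ·ᵥ w) i

T-scale : ∀ {n} a w (p : Profile n) i → T w (Vec.map (a *_) p) i ≡ a * T w p i
T-scale {n} a w p i = trans (cong (λ ps → sumℚ (map G (zip ps (lexPerms n)))) (VecP.toList-map (a *_) p))
  (sumℚ-zip-scale a G (λ q σ → ℚP.*-assoc a q _) (Vec.toList p) (lexPerms n))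
  where
  G : ℚ × Vec (Fin n) n → ℚ
  G (q , σ) = q * (R σ ·ᵥ w) i

-- The profile p₁

punchIn-fromℕ : ∀ {n} (k : Fin n) → Fin.punchIn (Fin.fromℕ n) k ≡ Fin.inject₁ k
punchIn-fromℕ Fin.zero    = refl
punchIn-fromℕ (Fin.suc k) = cong Fin.suc (punchIn-fromℕ k)

module _ {n : ℕ} where

  transpose-matchˡ : ∀ (i j : Fin n) → PC.transpose i j i ≡ j
  transpose-matchˡ i j with i ≟ i
  ... | yes _   = refl
  ... | no i≢i = ⊥-elim (i≢i refl)

  transpose-matchʳ : ∀ (i j : Fin n) → PC.transpose i j j ≡ i
  transpose-matchʳ i j with j ≟ i
  ... | yes j≡i = j≡i
  ... | no _ with j ≟ j
  ...   | yes _   = refl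
  ...   | no j≢j = ⊥-elim (j≢j refl)

  transpose-other : ∀ {i j k : Fin n} → k ≢ i → k ≢ j → PC.transpose i j k ≡ k
  transpose-other {i} {j} {k} k≢i k≢j with k ≟ i
  ... | yes k≡i = ⊥-elim (k≢i k≡i)
  ... | no _ with k ≟ j
  ...   | yes k≡j = ⊥-elim (k≢j k≡j)
  ...   | no _    = refl

module Profile₁ (m c κ : ℕ) where

  n′ n : ℕ
  n′ = suc m
  n  = suc n′

  last : Fin n
  last = Fin.fromℕ n′

  rotate : Permutation′ n
  rotate = Perm.insert last Fin.zero Perm.id

  swapEnds : Permutation′ n
  swapEnds = Perm.transpose Fin.zero last

  lastOf : Fin n′ → Permutation′ n
  lastOf b = Perm.transpose (Fin.suc b) last

  endPair : Fin n′ → Combination n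
  endPair b = (ι κ , lastOf b) ∷ (- ι κ , swapEnds ∘ₚ lastOf b) ∷ []

  p₁ : Profile n
  p₁ = profile ((ι c , rotate) ∷ (- ι c , Perm.id) ∷ concatMap endPair (allFin n′))

  endGap : (Fin n → ℚ) → Fin n → ℚ
  endGap w j = w j - w (swapEnds ⟨$⟩ˡ j)

  endGap-inner : ∀ w {j} → j ≢ Fin.zero → j ≢ last → endGap w j ≡ 0ℚ
  endGap-inner w {j} j≢0 j≢last = trans (cong (λ k → w j - w k) (transpose-other j≢last j≢0)) (ℚP.+-inverseʳ (w j))

  lastOf⁻¹-inner : ∀ b k → b ≢ k → (lastOf b ⟨$⟩ˡ Fin.suc k ≢ Fin.zero) × (lastOf b ⟨$⟩ˡ Fin.suc k ≢ last)
  lastOf⁻¹-inner b k b≢k =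
    (λ eq → FinP.0≢1+n (trans (sym (cong (lastOf b ⟨$⟩ʳ_) eq)) (Perm.inverseʳ (lastOf b) {Fin.suc k}))) ,
    λ eq → b≢k (FinP.suc-injective (trans (sym (transpose-matchʳ (Fin.suc b) last))
        (trans (sym (cong (lastOf b ⟨$⟩ʳ_) eq)) (Perm.inverseʳ (lastOf b) {Fin.suc k}))))

  T-p₁ : ∀ w i → T w p₁ i ≡ ι c * w (rotate ⟨$⟩ˡ i) + (- ι c * w i + ΣFin (λ b → ι κ * endGap w (lastOf b ⟨$⟩ˡ i)))
  T-p₁ w i = trans (T-profile ((ι c , rotate) ∷ (- ι c , Perm.id) ∷ concatMap endPair (allFin n′)) w i)
    (cong (λ x → ι c * w (rotate ⟨$⟩ˡ i) + (- ι c * w i + x))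
      (trans (sumℚ-concatMap (λ (c , ρ) → c * w (ρ ⟨$⟩ˡ i)) endPair (allFin n′)) (sumℚ-map-cong pair (allFin n′))))
    where
    open +-*-Solver
    pair : ∀ b → ι κ * w (lastOf b ⟨$⟩ˡ i) + (- ι κ * w ((swapEnds ∘ₚ lastOf b) ⟨$⟩ˡ i) + 0ℚ)
               ≡ ι κ * endGap w (lastOf b ⟨$⟩ˡ i)
    pair b = solve 3 (λ k x y → k :* x :+ (:- k :* y :+ con 0ℚ) := k :* (x :- y)) refl (ι κ) _ _

  -- Candidate 0 is first in every lastOf b, so each endPair contributes κ (w₀ − w_last) by computation.
  score-zero : ∀ w → T w p₁ Fin.zero ≡ (ι n′ * ι κ - ι c) * (w Fin.zero - w last)
  score-zero w = begin
    T w p₁ Fin.zero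
      ≡⟨ T-p₁ w Fin.zero ⟩
    ι c * w last + (- ι c * w Fin.zero + ΣFin {n′} (λ _ → ι κ * (w Fin.zero - w last)))
      ≡⟨ cong (λ x → ι c * w last + (- ι c * w Fin.zero + x)) (ΣFin-const {n′} (ι κ * (w Fin.zero - w last))) ⟩
    ι c * w last + (- ι c * w Fin.zero + ι n′ * (ι κ * (w Fin.zero - w last)))
      ≡⟨ solve 5 (λ a k c x y → c :* y :+ (:- c :* x :+ a :* (k :* (x :- y))) := (a :* k :- c) :* (x :- y))
           refl (ι n′) (ι κ) (ι c) (w Fin.zero) (w last) ⟩
    (ι n′ * ι κ - ι c) * (w Fin.zero - w last)
      ∎
    where
    open ≡-Reasoning
    open +-*-Solver

  score-suc : ∀ w k → T w p₁ (Fin.suc k) ≡ ι c * (w (Fin.inject₁ k) - w (Fin.suc k)) - ι κ * (w Fin.zero - w last)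
  score-suc w k = begin
    T w p₁ (Fin.suc k)
      ≡⟨ T-p₁ w (Fin.suc k) ⟩
    ι c * w (rotate ⟨$⟩ˡ Fin.suc k) + (- ι c * w (Fin.suc k) + ΣFin (λ b → ι κ * endGap w (lastOf b ⟨$⟩ˡ Fin.suc k)))
      ≡⟨ cong₂ (λ j x → ι c * w j + (- ι c * w (Fin.suc k) + x)) (punchIn-fromℕ k) (ΣFin-point _ k off) ⟩
    ι c * w (Fin.inject₁ k) + (- ι c * w (Fin.suc k) + ι κ * endGap w (lastOf k ⟨$⟩ˡ Fin.suc k))
      ≡⟨ cong (λ j → ι c * w (Fin.inject₁ k) + (- ι c * w (Fin.suc k) + ι κ * endGap w j)) (transpose-matchʳ last (Fin.suc k)) ⟩
    ι c * w (Fin.inject₁ k) + (- ι c * w (Fin.suc k) + ι κ * (w last - w (swapEnds ⟨$⟩ˡ last)))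
      ≡⟨ cong (λ j → ι c * w (Fin.inject₁ k) + (- ι c * w (Fin.suc k) + ι κ * (w last - w j))) (transpose-matchˡ last Fin.zero) ⟩
    ι c * w (Fin.inject₁ k) + (- ι c * w (Fin.suc k) + ι κ * (w last - w Fin.zero))
      ≡⟨ solve 6 (λ c k a b x y → c :* a :+ (:- c :* b :+ k :* (y :- x)) := c :* (a :- b) :- k :* (x :- y))
           refl (ι c) (ι κ) (w (Fin.inject₁ k)) (w (Fin.suc k)) (w Fin.zero) (w last) ⟩
    ι c * (w (Fin.inject₁ k) - w (Fin.suc k)) - ι κ * (w Fin.zero - w last)
      ∎
    where
    open ≡-Reasoning
    open +-*-Solver
    off : ∀ b → b ≢ k → ι κ * endGap w (lastOf b ⟨$⟩ˡ Fin.suc k) ≡ 0ℚ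
    off b b≢k = let (≢0 , ≢last) = lastOf⁻¹-inner b k b≢k in
      trans (cong (ι κ *_) (endGap-inner w ≢0 ≢last)) (ℚP.*-zeroʳ (ι κ))

-- Weighting vectors with prescribed gaps

centre : ∀ {n} → (Fin n → ℚ) → Fin n → ℚ
centre {n} a j = ΣFin a - ι n * a j

centre-sub : ∀ {n} (a : Fin n → ℚ) i j → centre a i - centre a j ≡ ι n * (a j - a i)
centre-sub {n} a i j = solve 4 (λ s k x y → (s :- k :* x) :- (s :- k :* y) := k :* (y :- x)) refl (ΣFin a) (ι n) (a i) (a j)
  where open +-*-Solver

centre-W : ∀ {m} (a : Fin (suc m) → ℚ) → (∀ i j → i Fin.< j → a i < a j) → W (centre a)
centre-W {m} a a-increasing = decreasing , sum≡0
  where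
  open +-*-Solver
  decreasing : ∀ i j → i Fin.< j → centre a j < centre a i
  decreasing i j i<j = ℚP.+-monoʳ-< (ΣFin a)
    (ℚP.neg-antimono-< (ℚP.*-monoʳ-<-pos (ι (suc m)) {{ℚ.positive (0<ι-suc m)}} (a-increasing i j i<j)))
  sum≡0 : ΣFin (centre a) ≡ 0ℚ
  sum≡0 = begin
    ΣFin (centre a)                                     ≡⟨ sumℚ-map-+ (λ _ → ΣFin a) (λ j → - (ι (suc m) * a j)) (allFin (suc m)) ⟩
    ΣFin {suc m} (λ _ → ΣFin a) + ΣFin (λ j → - (ι (suc m) * a j)) ≡⟨ cong₂ _+_ (ΣFin-const {suc m} (ΣFin a)) negated ⟩
    ι (suc m) * ΣFin a + - ι (suc m) * ΣFin a          ≡⟨ solve 2 (λ k s → k :* s :+ :- k :* s := con 0ℚ) refl (ι (suc m)) (ΣFin a) ⟩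
    0ℚ                                                   ∎
    where
    open ≡-Reasoning
    negated : ΣFin (λ j → - (ι (suc m) * a j)) ≡ - ι (suc m) * ΣFin a
    negated = trans (sumℚ-map-cong (λ j → ℚP.neg-distribˡ-* (ι (suc m)) (a j)) (allFin (suc m)))
      (sumℚ-map-*ˡ (- ι (suc m)) a (allFin (suc m)))

prefix : ∀ {m} → (Fin m → ℕ) → Fin (suc m) → ℕ
prefix         g Fin.zero    = 0
prefix {suc m} g (Fin.suc j) = g Fin.zero ℕ.+ prefix (g ∘ Fin.suc) j

total : ∀ {m} → (Fin m → ℕ) → ℕ
total {m} g = prefix g (Fin.fromℕ m)

prefix-suc : ∀ {m} (g : Fin m → ℕ) k → prefix g (Fin.suc k) ≡ prefix g (Fin.inject₁ k) ℕ.+ g k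
prefix-suc g Fin.zero    = ℕP.+-comm (g Fin.zero) 0
prefix-suc g (Fin.suc k) = trans (cong (g Fin.zero ℕ.+_) (prefix-suc (g ∘ Fin.suc) k)) (sym (ℕP.+-assoc (g Fin.zero) _ _))

prefix-increasing : ∀ {m} (g : Fin m → ℕ) → (∀ k → 0 ℕ.< g k) → ∀ i j → i Fin.< j → prefix g i ℕ.< prefix g j
prefix-increasing {suc m} g g>0 Fin.zero (Fin.suc j) _       = ℕP.<-≤-trans (g>0 Fin.zero) (ℕP.m≤m+n _ _)
prefix-increasing {suc m} g g>0 (Fin.suc i) (Fin.suc j) (s≤s i<j) =
  ℕP.+-monoʳ-< (g Fin.zero) (prefix-increasing (g ∘ Fin.suc) (g>0 ∘ Fin.suc) i j i<j)

total-lower : ∀ {m b} (g : Fin m → ℕ) → (∀ k → b ≤ g k) → m ℕ.* b ≤ total g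
total-lower {zero}  g _   = z≤n
total-lower {suc m} g b≤g = ℕP.+-mono-≤ (b≤g Fin.zero) (total-lower (g ∘ Fin.suc) (b≤g ∘ Fin.suc))

total-upper : ∀ {m u} (g : Fin m → ℕ) → (∀ k → g k ≤ u) → total g ≤ m ℕ.* u
total-upper {zero}  g _   = z≤n
total-upper {suc m} g g≤u = ℕP.+-mono-≤ (g≤u Fin.zero) (total-upper (g ∘ Fin.suc) (g≤u ∘ Fin.suc))

total-upper-deficit : ∀ {m u a} (g : Fin m → ℕ) → (∀ k → g k ≤ u) → ∀ k₀ → g k₀ ℕ.+ a ≤ u →
  total g ℕ.+ a ≤ m ℕ.* u
total-upper-deficit {suc m} {u} {a} g g≤u Fin.zero     deficit = begin
  g Fin.zero ℕ.+ total (g ∘ Fin.suc) ℕ.+ a   ≡⟨ ℕP.+-comm (g Fin.zero ℕ.+ _) a ⟩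
  a ℕ.+ (g Fin.zero ℕ.+ total (g ∘ Fin.suc)) ≡⟨ ℕP.+-assoc a (g Fin.zero) _ ⟨
  a ℕ.+ g Fin.zero ℕ.+ total (g ∘ Fin.suc)   ≤⟨ ℕP.+-mono-≤ (ℕP.≤-trans (ℕP.≤-reflexive (ℕP.+-comm a _)) deficit)
                                                              (total-upper (g ∘ Fin.suc) (g≤u ∘ Fin.suc)) ⟩
  u ℕ.+ m ℕ.* u                              ∎
  where open ℕP.≤-Reasoning
total-upper-deficit {suc m} {u} {a} g g≤u (Fin.suc k₀) deficit = begin
  g Fin.zero ℕ.+ total (g ∘ Fin.suc) ℕ.+ a   ≡⟨ ℕP.+-assoc (g Fin.zero) _ a ⟩
  g Fin.zero ℕ.+ (total (g ∘ Fin.suc) ℕ.+ a) ≤⟨ ℕP.+-mono-≤ (g≤u Fin.zero)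
                                                  (total-upper-deficit (g ∘ Fin.suc) (g≤u ∘ Fin.suc) k₀ deficit) ⟩
  u ℕ.+ m ℕ.* u                              ∎
  where open ℕP.≤-Reasoning

-- Realising a ranking

<-from-≡+suc : ∀ {a b} e → b ≡ a ℕ.+ suc e → a ℕ.< b
<-from-≡+suc {a} e refl = ℕP.m<m+n a (s≤s z≤n)

-- c = n(2n − 3) and κ = 2n − 1, so that n′κ = c + 1.
module Constants (t : ℕ) where

  n n′ c κ base bonus gapMax : ℕ
  n      = 3 ℕ.+ t
  n′     = 2 ℕ.+ t
  c      = (3 ℕ.+ t) ℕ.* (3 ℕ.+ 2 ℕ.* t)
  κ      = 5 ℕ.+ 2 ℕ.* t
  base   = 2 ℕ.* (n ℕ.* n)
  bonus  = 4 ℕ.* (n ℕ.* n)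
  gapMax = base ℕ.+ n ℕ.+ bonus

  n′κ≡1+c : n′ ℕ.* κ ≡ suc c
  n′κ≡1+c = solve 1 (λ t → (con 2 :+ t) :* (con 5 :+ con 2 :* t) := con 1 :+ (con 3 :+ t) :* (con 3 :+ con 2 :* t)) refl t
    where open ℕ-Solver

  ι-n′κ : ι n′ * ι κ ≡ 1ℚ + ι c
  ι-n′κ = trans (sym (ι-* n′ κ)) (cong ι n′κ≡1+c)

  below-candidate₀ : ∀ {d D} → d ≤ base ℕ.+ n → n′ ℕ.* base ≤ D → c ℕ.* d ℕ.< suc κ ℕ.* D
  below-candidate₀ {d} {D} d≤ D≥ = begin-strict
    c ℕ.* d                 ≤⟨ ℕP.*-monoʳ-≤ c d≤ ⟩
    c ℕ.* (base ℕ.+ n)      <⟨ <-from-≡+suc (3 ℕ.* (t ℕ.* t) ℕ.+ 18 ℕ.* t ℕ.+ 26) identity ⟩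
    suc κ ℕ.* (n′ ℕ.* base) ≤⟨ ℕP.*-monoʳ-≤ (suc κ) D≥ ⟩
    suc κ ℕ.* D             ∎
    where
    open ℕP.≤-Reasoning
    identity : suc κ ℕ.* (n′ ℕ.* base) ≡ c ℕ.* (base ℕ.+ n) ℕ.+ suc (3 ℕ.* (t ℕ.* t) ℕ.+ 18 ℕ.* t ℕ.+ 26)
    identity = solve 1 (λ t → let n = con 3 :+ t ; b = con 2 :* (n :* n) in
        (con 6 :+ con 2 :* t) :* ((con 2 :+ t) :* b)
      := (con 3 :+ t) :* (con 3 :+ con 2 :* t) :* (b :+ n) :+ (con 1 :+ (con 3 :* (t :* t) :+ con 18 :* t :+ con 26))) refl t
      where open ℕ-Solver

  above-candidate₀ : ∀ {d D} → base ℕ.+ 1 ℕ.+ bonus ≤ d → D ℕ.+ bonus ≤ n′ ℕ.* gapMax → suc κ ℕ.* D ℕ.< c ℕ.* d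
  above-candidate₀ {d} {D} d≥ D≤ = ℕP.+-cancelʳ-< (suc κ ℕ.* bonus) _ _ (begin-strict
    suc κ ℕ.* D ℕ.+ suc κ ℕ.* bonus                  ≡⟨ ℕP.*-distribˡ-+ (suc κ) D bonus ⟨
    suc κ ℕ.* (D ℕ.+ bonus)                          ≤⟨ ℕP.*-monoʳ-≤ (suc κ) D≤ ⟩
    suc κ ℕ.* (n′ ℕ.* gapMax)                        <⟨ <-from-≡+suc (4 ℕ.* (t ℕ.* t) ℕ.+ 21 ℕ.* t ℕ.+ 26) identity ⟩
    c ℕ.* (base ℕ.+ 1 ℕ.+ bonus) ℕ.+ suc κ ℕ.* bonus ≤⟨ ℕP.+-monoˡ-≤ (suc κ ℕ.* bonus) (ℕP.*-monoʳ-≤ c d≥) ⟩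
    c ℕ.* d ℕ.+ suc κ ℕ.* bonus                      ∎)
    where
    open ℕP.≤-Reasoning
    identity : c ℕ.* (base ℕ.+ 1 ℕ.+ bonus) ℕ.+ suc κ ℕ.* bonus
             ≡ suc κ ℕ.* (n′ ℕ.* gapMax) ℕ.+ suc (4 ℕ.* (t ℕ.* t) ℕ.+ 21 ℕ.* t ℕ.+ 26)
    identity = solve 1 (λ t → let n = con 3 :+ t ; b = con 2 :* (n :* n) ; a = con 4 :* (n :* n) in
        (con 3 :+ t) :* (con 3 :+ con 2 :* t) :* (b :+ con 1 :+ a) :+ (con 6 :+ con 2 :* t) :* a
      := (con 6 :+ con 2 :* t) :* ((con 2 :+ t) :* (b :+ n :+ a)) :+ (con 1 :+ (con 4 :* (t :* t) :+ con 21 :* t :+ con 26))) refl t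
      where open ℕ-Solver

C-from-ranks : ∀ {n} (π : Permutation′ n) (x : Fin n → ℚ) → (∀ a b → π ⟨$⟩ˡ a Fin.< π ⟨$⟩ˡ b → x b < x a) → C π x
C-from-ranks π x ordered k l k<l =
  ordered (π ⟨$⟩ʳ k) (π ⟨$⟩ʳ l) (subst₂ Fin._<_ (sym (Perm.inverseˡ π)) (sym (Perm.inverseˡ π)) k<l)

C-map : ∀ {n} (π : Permutation′ n) {x y : Fin n → ℚ} (f : ℚ → ℚ) → (∀ {u v} → u < v → f u < f v) →
  (∀ j → y j ≡ f (x j)) → C π x → C π y
C-map π f f-mono y≡fx Cx k l k<l = subst₂ _<_ (sym (y≡fx _)) (sym (y≡fx _)) (f-mono (Cx k l k<l))

module Ranking (t : ℕ) (π : Permutation′ (3 ℕ.+ t)) where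

  open Constants t
  open Profile₁ (suc t) c κ using (last; p₁; score-zero; score-suc)

  rank : Fin n → ℕ
  rank x = Fin.toℕ (π ⟨$⟩ˡ x)

  aboveBonus : Fin n → ℕ
  aboveBonus x with rank x ℕ.<? rank Fin.zero
  ... | yes _ = bonus
  ... | no _  = 0

  gap : Fin n → ℕ
  gap x = base ℕ.+ (n ∸ rank x) ℕ.+ aboveBonus x

  base<gap : ∀ x → base ℕ.< gap x
  base<gap x = ℕP.<-≤-trans (ℕP.m<m+n base (ℕP.m<n⇒0<n∸m (FinP.toℕ<n (π ⟨$⟩ˡ x)))) (ℕP.m≤m+n _ _)

  gap-above : ∀ x → rank x ℕ.< rank Fin.zero → base ℕ.+ 1 ℕ.+ bonus ≤ gap x
  gap-above x above with rank x ℕ.<? rank Fin.zero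
  ... | yes _      = ℕP.+-monoˡ-≤ bonus (ℕP.+-monoʳ-≤ base (ℕP.m<n⇒0<n∸m (FinP.toℕ<n (π ⟨$⟩ˡ x))))
  ... | no ¬above = ⊥-elim (¬above above)

  gap-below : ∀ x → ¬ (rank x ℕ.< rank Fin.zero) → gap x ≤ base ℕ.+ n
  gap-below x ¬above with rank x ℕ.<? rank Fin.zero
  ... | yes above = ⊥-elim (¬above above)
  ... | no _      = ℕP.≤-trans (ℕP.≤-reflexive (ℕP.+-identityʳ _)) (ℕP.+-monoʳ-≤ base (ℕP.m∸n≤m n (rank x)))

  gap≤gapMax : ∀ x → gap x ≤ gapMax
  gap≤gapMax x = ℕP.+-mono-≤ (ℕP.+-monoʳ-≤ base (ℕP.m∸n≤m n (rank x))) bonus-bound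
    where
    bonus-bound : aboveBonus x ≤ bonus
    bonus-bound with rank x ℕ.<? rank Fin.zero
    ... | yes _ = ℕP.≤-refl
    ... | no _  = z≤n

  gap-antitone : ∀ x y → rank x ℕ.< rank y → gap y ℕ.< gap x
  gap-antitone x y x<y =
    ℕP.+-mono-<-≤ (ℕP.+-monoʳ-< base (ℕP.∸-monoʳ-< x<y (ℕP.<⇒≤ (FinP.toℕ<n (π ⟨$⟩ˡ y))))) bonus-antitone
    where
    bonus-antitone : aboveBonus y ≤ aboveBonus x
    bonus-antitone with rank y ℕ.<? rank Fin.zero | rank x ℕ.<? rank Fin.zero
    ... | yes _       | yes _      = ℕP.≤-refl
    ... | no _        | _          = z≤n
    ... | yes y-above | no ¬above = ⊥-elim (¬above (ℕP.<-trans x<y y-above))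

  D : ℕ
  D = total (gap ∘ Fin.suc)

  D-lower : n′ ℕ.* base ≤ D
  D-lower = total-lower (gap ∘ Fin.suc) (ℕP.<⇒≤ ∘ base<gap ∘ Fin.suc)

  -- The only use of LastNotFirst: the candidate placed last is below candidate 0, so its gap has no bonus.
  D-upper : LastNotFirst π → D ℕ.+ bonus ≤ n′ ℕ.* gapMax
  D-upper lnf with π ⟨$⟩ʳ last in π-last
  ... | Fin.zero    = ⊥-elim (lnf last (FinP.toℕ-fromℕ n′) (cong Fin.toℕ π-last))
  ... | Fin.suc k₀ = total-upper-deficit (gap ∘ Fin.suc) (gap≤gapMax ∘ Fin.suc) k₀
    (ℕP.+-monoˡ-≤ bonus (gap-below (Fin.suc k₀) not-above))
    where
    rank-k₀ : rank (Fin.suc k₀) ≡ n′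
    rank-k₀ = trans (cong (Fin.toℕ ∘ (π ⟨$⟩ˡ_)) (sym π-last)) (trans (cong Fin.toℕ (Perm.inverseˡ π)) (FinP.toℕ-fromℕ n′))
    not-above : ¬ (rank (Fin.suc k₀) ℕ.< rank Fin.zero)
    not-above above = ℕP.<⇒≱ (subst (ℕ._< rank Fin.zero) rank-k₀ above) (ℕP.≤-pred (FinP.toℕ<n (π ⟨$⟩ˡ Fin.zero)))

  levels : Fin n → ℚ
  levels j = ι (prefix (gap ∘ Fin.suc) j)

  weights : Fin n → ℚ
  weights = centre levels

  weights-W : W weights
  weights-W = centre-W levels λ i j i<j →
    ι-mono-< (prefix-increasing (gap ∘ Fin.suc) (λ k → ℕP.≤-<-trans z≤n (base<gap (Fin.suc k))) i j i<j)

  ζ : Fin n → ℕ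
  ζ Fin.zero    = suc κ ℕ.* D
  ζ (Fin.suc k) = c ℕ.* gap (Fin.suc k)

  T-weights : ∀ j → T weights p₁ j ≡ ι n * ι (ζ j) - ι n * ι (κ ℕ.* D)
  T-weights Fin.zero = begin
    T weights p₁ Fin.zero
      ≡⟨ score-zero weights ⟩
    (ι n′ * ι κ - ι c) * (weights Fin.zero - weights last)
      ≡⟨ cong₂ (λ a b → (a - ι c) * b) ι-n′κ (centre-sub levels Fin.zero last) ⟩
    (1ℚ + ι c - ι c) * (ι n * (ι D - 0ℚ))
      ≡⟨ solve 4 (λ c m d e → (con 1ℚ :+ c :- c) :* (m :* (d :- con 0ℚ)) := m :* (d :+ e) :- m :* e)
           refl (ι c) (ι n) (ι D) (ι (κ ℕ.* D)) ⟩
    ι n * (ι D + ι (κ ℕ.* D)) - ι n * ι (κ ℕ.* D)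
      ≡⟨ cong (λ x → ι n * x - ι n * ι (κ ℕ.* D)) (ι-+ D (κ ℕ.* D)) ⟨
    ι n * ι (suc κ ℕ.* D) - ι n * ι (κ ℕ.* D)
      ∎
    where
    open ≡-Reasoning
    open +-*-Solver
  T-weights (Fin.suc k) = begin
    T weights p₁ (Fin.suc k)
      ≡⟨ score-suc weights k ⟩
    ι c * (weights (Fin.inject₁ k) - weights (Fin.suc k)) - ι κ * (weights Fin.zero - weights last)
      ≡⟨ cong₂ (λ a b → ι c * a - ι κ * b) (centre-sub levels (Fin.inject₁ k) (Fin.suc k)) (centre-sub levels Fin.zero last) ⟩
    ι c * (ι n * (levels (Fin.suc k) - levels (Fin.inject₁ k))) - ι κ * (ι n * (ι D - 0ℚ))
      ≡⟨ cong (λ x → ι c * (ι n * (x - levels (Fin.inject₁ k))) - ι κ * (ι n * (ι D - 0ℚ)))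
           (trans (cong ι (prefix-suc (gap ∘ Fin.suc) k)) (ι-+ (prefix (gap ∘ Fin.suc) (Fin.inject₁ k)) (gap (Fin.suc k)))) ⟩
    ι c * (ι n * (levels (Fin.inject₁ k) + ι (gap (Fin.suc k)) - levels (Fin.inject₁ k))) - ι κ * (ι n * (ι D - 0ℚ))
      ≡⟨ solve 6 (λ c k m l g d → c :* (m :* (l :+ g :- l)) :- k :* (m :* (d :- con 0ℚ)) := m :* (c :* g) :- m :* (k :* d))
           refl (ι c) (ι κ) (ι n) (levels (Fin.inject₁ k)) (ι (gap (Fin.suc k))) (ι D) ⟩
    ι n * (ι c * ι (gap (Fin.suc k))) - ι n * (ι κ * ι D)
      ≡⟨ cong₂ (λ a b → ι n * a - ι n * b) (ι-* c (gap (Fin.suc k))) (ι-* κ D) ⟨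
    ι n * ι (c ℕ.* gap (Fin.suc k)) - ι n * ι (κ ℕ.* D)
      ∎
    where
    open ≡-Reasoning
    open +-*-Solver

  ζ-ordered : LastNotFirst π → ∀ x y → rank x ℕ.< rank y → ζ y ℕ.< ζ x
  ζ-ordered lnf Fin.zero    Fin.zero    x<y = ⊥-elim (ℕP.<-irrefl refl x<y)
  ζ-ordered lnf Fin.zero    (Fin.suc b) x<y = below-candidate₀ {D = D} (gap-below (Fin.suc b) (ℕP.<-asym x<y)) D-lower
  ζ-ordered lnf (Fin.suc a) Fin.zero    x<y = above-candidate₀ {D = D} (gap-above (Fin.suc a) x<y) (D-upper lnf)
  ζ-ordered lnf (Fin.suc a) (Fin.suc b) x<y = ℕP.*-monoʳ-< c (gap-antitone (Fin.suc a) (Fin.suc b) x<y)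

  weights-C : LastNotFirst π → C π (T weights p₁)
  weights-C lnf = C-map π (λ u → ι n * u - ι n * ι (κ ℕ.* D))
    (λ u<v → ℚP.+-monoˡ-< (- (ι n * ι (κ ℕ.* D))) (ℚP.*-monoʳ-<-pos (ι n) {{ℚ.positive (0<ι-suc n′)}} u<v))
    T-weights
    (C-from-ranks π (ι ∘ ζ) λ x y x<y → ι-mono-< (ζ-ordered lnf x y x<y))

-- Infinitely many profiles

module _ (r : A → ℚ) (L : List A) where

  strictUpperBound : ℚ
  strictUpperBound = 1ℚ + max 0ℚ (map r L)

  max<strictUpperBound : max 0ℚ (map r L) < strictUpperBound
  max<strictUpperBound = subst (_< strictUpperBound) (ℚP.+-identityˡ _) (ℚP.+-monoˡ-< (max 0ℚ (map r L)) (ℚP.positive⁻¹ 1ℚ))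

  0<strictUpperBound : 0ℚ < strictUpperBound
  0<strictUpperBound = ℚP.≤-<-trans (v≤max⁺ 0ℚ (map r L) (inj₁ ℚP.≤-refl)) max<strictUpperBound

  <strictUpperBound : ∀ {p} → p ∈ L → r p < strictUpperBound
  <strictUpperBound p∈L = ℚP.≤-<-trans (All.lookup (xs≤max 0ℚ (map r L)) (∈-map⁺ r p∈L)) max<strictUpperBound

module FreshProfile (t : ℕ) (L : List (Profile (3 ℕ.+ t))) where

  open Constants t using (n′; c; κ; ι-n′κ)
  open Profile₁ (suc t) c κ using (score-zero)
  open Profile₁ (suc t) c κ public using (p₁)

  e₀ : Fin (3 ℕ.+ t) → ℚ
  e₀ Fin.zero    = 1ℚ
  e₀ (Fin.suc _) = 0ℚ

  r : Profile (3 ℕ.+ t) → ℚ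
  r p = T e₀ p Fin.zero

  y : ℚ
  y = strictUpperBound r L

  0<y : 0ℚ < y
  0<y = 0<strictUpperBound r L

  P : Profile (3 ℕ.+ t)
  P = Vec.map (y *_) p₁

  r-P : r P ≡ y
  r-P = begin
    r P                                   ≡⟨ T-scale y e₀ p₁ Fin.zero ⟩
    y * r p₁                              ≡⟨ cong (y *_) (score-zero e₀) ⟩
    y * ((ι n′ * ι κ - ι c) * (1ℚ - 0ℚ))  ≡⟨ cong (λ a → y * ((a - ι c) * (1ℚ - 0ℚ))) ι-n′κ ⟩
    y * ((1ℚ + ι c - ι c) * (1ℚ - 0ℚ))    ≡⟨ solve 2 (λ y c → y :* ((con 1ℚ :+ c :- c) :* (con 1ℚ :- con 0ℚ)) := y)
                                               refl y (ι c) ⟩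
    y                                     ∎
    where
    open ≡-Reasoning
    open +-*-Solver

  P∉L : P ∉ L
  P∉L P∈L = ℚP.<-irrefl r-P (<strictUpperBound r L P∈L)

theorem3p6 : (n : ℕ) → 3 ≤ n → (L : List (Profile n)) →
    ∃ λ (p : Profile n) → p ∉ L ×
      ((π : Permutation′ n) → LastNotFirst π →
        Σ (Fin n → ℚ) λ w → W w × C π (T w p))
theorem3p6 (suc (suc (suc t))) (s≤s (s≤s (s≤s z≤n))) L = P , P∉L , realised
  where
  open FreshProfile t L
  realised : (π : Permutation′ (3 ℕ.+ t)) → LastNotFirst π → Σ (Fin (3 ℕ.+ t) → ℚ) λ w → W w × C π (T w P)
  realised π lnf = weights , weights-W ,
    C-map π (y *_) (ℚP.*-monoʳ-<-pos y {{ℚ.positive 0<y}}) (T-scale y weights p₁) (weights-C lnf)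
    where open Ranking t π
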